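{- Let $\mathcal L$ be a summable category with summability structure $(S,\pi_0,\pi_1,\sigma)$, and let $f_0,f_1\in\mathcal L(X,Y)$ be summable. Then $Sf_0,Sf_1\in\mathcal L(SX,SY)$ are summable, with witness $\langle Sf_0,Sf_1\rangle_S=c_Y\circ S\langle f_0,f_1\rangle_S\in\mathcal L(SX,S^2Y)$, and $Sf_0+Sf_1=S(f_0+f_1)$.
   Context: Let $\mathcal L$ be a category enriched over pointed sets (each hom-set has a distinguished $0$ with $g\circ 0=0$, $0\circ f=0$). A pre-summability structure is $(S,\pi_0,\pi_1,\sigma)$ with $S:\mathcal L\to\mathcal L$ a functor, $S0=0$, and $\pi_0,\pi_1,\sigma$ natural transformations $S\Rightarrow\mathrm{Id}$ with $\pi_0,\pi_1$ jointly monic. $f_0,f_1\in\mathcal L(X,Y)$ are summable if there is (necessarily unique) $\langle f_0,f_1\rangle_S\in\mathcal L(X,SY)$ with $\pi_i\circ\langle f_0,f_1\rangle_S=f_i$; then $f_0+f_1:=\sigma\circ\langle f_0,f_1\rangle_S$. A summable category is one equipped with such a structure satisfying: (S-com) $\pi_1,\pi_0$ are summable and $\sigma\circ\langle\pi_1,\pi_0\rangle_S=\sigma$; (S-zero) for each $f$, $f$ and $0$ are summable with $f+0=f$; (S-witness) if $(f_{00},f_{01})$, $(f_{10},f_{11})$ are summable and $(f_{00}+f_{01},f_{10}+f_{11})$ is summable then $\langle f_{00},f_{01}\rangle_S,\langle f_{10},f_{11}\rangle_S$ are summable; (S-assoc) $S(\sigma_X)\circ c_X=\sigma_{SX}$,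 where $c_X\in\mathcal L(S^2X,S^2X)$ (the "flip") is the unique morphism with $\pi_{i,X}\circ\pi_{j,SX}\circ c_X=\pi_{j,X}\circ\pi_{i,SX}$ for all $i,j\in\{0,1\}$. -}

module Defs where

open import Level using (Level; _⊔_; suc)
open import Data.Product using (Σ; _×_; _,_; proj₁; proj₂)
open import Relation.Binary.PropositionalEquality using (_≡_)

-- A category enriched over pointed sets (hom-sets are types with
-- equality _≡_; each hom-set has a distinguished zero morphism 0m
-- absorbing under composition on both sides).
record PointedCategory (o ℓ : Level) : Set (suc (o ⊔ ℓ)) where
  infixr 9 _∘_
  field
    Obj  : Set o
    Hom  : Obj → Obj → Set ℓ
    id   : ∀ {X} → Hom X X
    _∘_  : ∀ {X Y Z} → Hom Y Z → Hom X Y → Hom X Z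
    assoc : ∀ {W X Y Z} (h : Hom Y Z) (g : Hom X Y) (f : Hom W X) →
            (h ∘ g) ∘ f ≡ h ∘ (g ∘ f)
    identityˡ : ∀ {X Y} (f : Hom X Y) → id ∘ f ≡ f
    identityʳ : ∀ {X Y} (f : Hom X Y) → f ∘ id ≡ f
    0m   : ∀ {X Y} → Hom X Y
    zeroˡ : ∀ {X Y Z} (g : Hom Y Z) → g ∘ 0m {X} {Y} ≡ 0m
    zeroʳ : ∀ {X Y Z} (f : Hom X Y) → 0m {Y} {Z} ∘ f ≡ 0m

module _ {o ℓ : Level} (𝓛 : PointedCategory o ℓ) where
  open PointedCategory 𝓛

  record PreSummability : Set (o ⊔ ℓ) where
    field
      S₀     : Obj → Obj
      S₁     : ∀ {X Y} → Hom X Y → Hom (S₀ X) (S₀ Y)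
      S-id   : ∀ {X} → S₁ (id {X}) ≡ id
      S-∘    : ∀ {X Y Z} (g : Hom Y Z) (f : Hom X Y) → S₁ (g ∘ f) ≡ S₁ g ∘ S₁ f
      S-0    : ∀ {X Y} → S₁ (0m {X} {Y}) ≡ 0m
      π₀     : ∀ X → Hom (S₀ X) X
      π₁     : ∀ X → Hom (S₀ X) X
      σ      : ∀ X → Hom (S₀ X) X
      π₀-nat : ∀ {X Y} (f : Hom X Y) → π₀ Y ∘ S₁ f ≡ f ∘ π₀ X
      π₁-nat : ∀ {X Y} (f : Hom X Y) → π₁ Y ∘ S₁ f ≡ f ∘ π₁ X
      σ-nat  : ∀ {X Y} (f : Hom X Y) → σ Y ∘ S₁ f ≡ f ∘ σ X
      π-jointly-monic : ∀ {Z X} (g h : Hom Z (S₀ X)) →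
        π₀ X ∘ g ≡ π₀ X ∘ h → π₁ X ∘ g ≡ π₁ X ∘ h → g ≡ h

    -- f₀, f₁ summable: a witness ⟨f₀,f₁⟩_S exists (unique by joint monicity).
    Summable : ∀ {X Y} → Hom X Y → Hom X Y → Set ℓ
    Summable {X} {Y} f₀ f₁ =
      Σ (Hom X (S₀ Y)) λ w → (π₀ Y ∘ w ≡ f₀) × (π₁ Y ∘ w ≡ f₁)

    ⟨_⟩S : ∀ {X Y} {f₀ f₁ : Hom X Y} → Summable f₀ f₁ → Hom X (S₀ Y)
    ⟨ p ⟩S = proj₁ p

    sum : ∀ {X Y} {f₀ f₁ : Hom X Y} → Summable f₀ f₁ → Hom X Y
    sum {Y = Y} p = σ Y ∘ ⟨ p ⟩S

    IsFlip : ∀ X → Hom (S₀ (S₀ X)) (S₀ (S₀ X)) → Set ℓ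
    IsFlip X c =
      (π₀ X ∘ π₀ (S₀ X) ∘ c ≡ π₀ X ∘ π₀ (S₀ X)) ×
      (π₀ X ∘ π₁ (S₀ X) ∘ c ≡ π₁ X ∘ π₀ (S₀ X)) ×
      (π₁ X ∘ π₀ (S₀ X) ∘ c ≡ π₀ X ∘ π₁ (S₀ X)) ×
      (π₁ X ∘ π₁ (S₀ X) ∘ c ≡ π₁ X ∘ π₁ (S₀ X))

  record Summability : Set (o ⊔ ℓ) where
    field
      pre : PreSummability
    open PreSummability pre
    field
      S-com-sum : ∀ X → Summable (π₁ X) (π₀ X)
      S-com     : ∀ X → sum (S-com-sum X) ≡ σ X
      S-zero-sum : ∀ {X Y} (f : Hom X Y) → Summable f 0m
      S-zero     : ∀ {X Y} (f : Hom X Y) → sum (S-zero-sum f) ≡ f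
      S-witness : ∀ {X Y} {f₀₀ f₀₁ f₁₀ f₁₁ : Hom X Y}
        (p₀ : Summable f₀₀ f₀₁) (p₁ : Summable f₁₀ f₁₁) →
        Summable (sum p₀) (sum p₁) → Summable ⟨ p₀ ⟩S ⟨ p₁ ⟩S
      -- The flip c_X (the unique morphism with the flip property;
      -- uniqueness follows from joint monicity).
      c      : ∀ X → Hom (S₀ (S₀ X)) (S₀ (S₀ X))
      c-flip : ∀ X → IsFlip X (c X)
      S-assoc : ∀ X → S₁ (σ X) ∘ c X ≡ σ (S₀ X)

{-# OPTIONS --safe #-}
module Submission where

open import Defs
open import Level using (Level)
open import Data.Bool using (Bool; false; true)
open import Data.Product using (Σ; _×_; proj₁; proj₂; _,_)
open import Relation.Binary.PropositionalEquality
  using (_≡_; refl; sym; trans; cong; module ≡-Reasoning)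

-- The flip c satisfies π i ∘ π j ∘ c ≡ π j ∘ π i, so it is an involution by joint
-- monicity of the π's, and c ∘ S⟨f₀,f₁⟩ has components π i ∘ π j ∘ c ∘ S w = π j ∘ w ∘ π i
-- = f_j ∘ π i = π i ∘ S f_j, i.e. it witnesses (S f₀, S f₁). Its sum is then
-- σ ∘ c ∘ S w = S σ ∘ c ∘ c ∘ S w = S (σ ∘ w) by (S-assoc) and c ∘ c = id.

module Reassociation {o ℓ : Level} (𝓛 : PointedCategory o ℓ) where
  open PointedCategory 𝓛

  pullˡ : ∀ {W X Y Z} {h : Hom Y Z} {g : Hom X Y} {k : Hom X Z} (f : Hom W X) →
    h ∘ g ≡ k → h ∘ g ∘ f ≡ k ∘ f
  pullˡ f hg≡k = trans (sym (assoc _ _ f)) (cong (_∘ f) hg≡k)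

module FlipProperties {o ℓ : Level} (𝓛 : PointedCategory o ℓ) (𝓟 : PreSummability 𝓛) where
  open PointedCategory 𝓛
  open PreSummability 𝓟
  open Reassociation 𝓛
  open ≡-Reasoning

  π : Bool → ∀ X → Hom (S₀ X) X
  π false = π₀
  π true  = π₁

  π-nat : ∀ i {X Y} (f : Hom X Y) → π i Y ∘ S₁ f ≡ f ∘ π i X
  π-nat false = π₀-nat
  π-nat true  = π₁-nat

  π-jointly-monic′ : ∀ {Z X} {g h : Hom Z (S₀ X)} →
    (∀ i → π i X ∘ g ≡ π i X ∘ h) → g ≡ h
  π-jointly-monic′ e = π-jointly-monic _ _ (e false) (e true)

  π²-jointly-monic : ∀ {Z X} {g h : Hom Z (S₀ (S₀ X))} →
    (∀ i j → π i X ∘ π j (S₀ X) ∘ g ≡ π i X ∘ π j (S₀ X) ∘ h) → g ≡ h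
  π²-jointly-monic e =
    π-jointly-monic′ λ j → π-jointly-monic′ λ i → e i j

  module _ {X : Obj} {c : Hom (S₀ (S₀ X)) (S₀ (S₀ X))} (c-flip : IsFlip X c) where

    IsFlip⇒π-swap : ∀ i j → π i X ∘ π j (S₀ X) ∘ c ≡ π j X ∘ π i (S₀ X)
    IsFlip⇒π-swap false false = proj₁ c-flip
    IsFlip⇒π-swap false true  = proj₁ (proj₂ c-flip)
    IsFlip⇒π-swap true  false = proj₁ (proj₂ (proj₂ c-flip))
    IsFlip⇒π-swap true  true  = proj₂ (proj₂ (proj₂ c-flip))

    π-swap-∘ : ∀ {Z} i j (g : Hom Z (S₀ (S₀ X))) →
      π i X ∘ π j (S₀ X) ∘ c ∘ g ≡ π j X ∘ π i (S₀ X) ∘ g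
    π-swap-∘ i j g = begin
      π i X ∘ π j (S₀ X) ∘ c ∘ g     ≡⟨ cong (π i X ∘_) (sym (assoc _ _ _)) ⟩
      π i X ∘ (π j (S₀ X) ∘ c) ∘ g   ≡⟨ pullˡ g (IsFlip⇒π-swap i j) ⟩
      (π j X ∘ π i (S₀ X)) ∘ g       ≡⟨ assoc _ _ _ ⟩
      π j X ∘ π i (S₀ X) ∘ g         ∎

    flip-involutive : ∀ {Z} (g : Hom Z (S₀ (S₀ X))) → c ∘ c ∘ g ≡ g
    flip-involutive g = π²-jointly-monic λ i j → trans (π-swap-∘ i j (c ∘ g)) (π-swap-∘ j i g)

module SummabilityOfS {o ℓ : Level} (𝓛 : PointedCategory o ℓ) (𝓟 : PreSummability 𝓛) where
  open PointedCategory 𝓛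
  open PreSummability 𝓟
  open Reassociation 𝓛
  open FlipProperties 𝓛 𝓟
  open ≡-Reasoning

  module _ {X Y : Obj} {c : Hom (S₀ (S₀ Y)) (S₀ (S₀ Y))} (c-flip : IsFlip Y c) where

    flip-∘-S-witness : {w : Hom X (S₀ Y)} {f : Hom X Y} (k : Bool) →
      π k Y ∘ w ≡ f → π k (S₀ Y) ∘ c ∘ S₁ w ≡ S₁ f
    flip-∘-S-witness {w} {f} k πₖw≡f = π-jointly-monic′ λ i → begin
      π i Y ∘ π k (S₀ Y) ∘ c ∘ S₁ w  ≡⟨ π-swap-∘ c-flip i k (S₁ w) ⟩
      π k Y ∘ π i (S₀ Y) ∘ S₁ w      ≡⟨ cong (π k Y ∘_) (π-nat i w) ⟩
      π k Y ∘ w ∘ π i X              ≡⟨ pullˡ (π i X) πₖw≡f ⟩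
      f ∘ π i X                      ≡⟨ sym (π-nat i f) ⟩
      π i Y ∘ S₁ f                   ∎

    S-summable : {f₀ f₁ : Hom X Y} → Summable f₀ f₁ → Summable (S₁ f₀) (S₁ f₁)
    S-summable (w , π₀w≡f₀ , π₁w≡f₁) =
      c ∘ S₁ w , flip-∘-S-witness false π₀w≡f₀ , flip-∘-S-witness true π₁w≡f₁

    S-summable-sum : S₁ (σ Y) ∘ c ≡ σ (S₀ Y) →
      {f₀ f₁ : Hom X Y} (p : Summable f₀ f₁) → sum (S-summable p) ≡ S₁ (sum p)
    S-summable-sum S-assoc (w , _) = begin
      σ (S₀ Y) ∘ c ∘ S₁ w          ≡⟨ cong (_∘ (c ∘ S₁ w)) (sym S-assoc) ⟩
      (S₁ (σ Y) ∘ c) ∘ c ∘ S₁ w    ≡⟨ assoc _ _ _ ⟩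
      S₁ (σ Y) ∘ c ∘ c ∘ S₁ w      ≡⟨ cong (S₁ (σ Y) ∘_) (flip-involutive c-flip (S₁ w)) ⟩
      S₁ (σ Y) ∘ S₁ w              ≡⟨ sym (S-∘ _ _) ⟩
      S₁ (σ Y ∘ w)                 ∎

mainTheorem3 : ∀ {o ℓ : Level} (𝓛 : PointedCategory o ℓ) (𝓢 : Summability 𝓛) →
    let open PointedCategory 𝓛
        open Summability 𝓢
        open PreSummability pre
    in ∀ {X Y} {f₀ f₁ : Hom X Y} (p : Summable f₀ f₁) →
       Σ (Summable (S₁ f₀) (S₁ f₁)) λ q →
         (⟨ q ⟩S ≡ c Y ∘ S₁ ⟨ p ⟩S) × (sum q ≡ S₁ (sum p))
mainTheorem3 𝓛 𝓢 {Y = Y} p =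
  S-summable (c-flip Y) p , refl , S-summable-sum (c-flip Y) (S-assoc Y) p
  where
  open Summability 𝓢
  open SummabilityOfS 𝓛 pre
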